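{- Let $\mathcal{F}=\langle W,R,\{S_w\}_{w\in W}\rangle$ be a Veltman frame, let $f$ be an ultrafilter on $W$ and $A,B\subseteq W$ with $\overline{S^{ -1}(A,B)}\in f$. Then there exist an ultrafilter $g$ on $W$ and a proper filter $l$ on $W$ such that $A\in g$, $\overline{B}\in l$ and $f\prec_l g$.
   Context: A Veltman frame is $\langle W,R,\{S_w\}\rangle$ where: - $W$ is nonempty. - $R$ is transitive and conversely well-founded. - Each $S_w$ is a reflexive transitive relation on $R[w]=\{v:wRv\}$ containing $R\cap R[w]^2$. For $X,Y\subseteq W$: - $\overline{Y}=W\setminus Y$. - $\widehat{R^{ -1}}(Y)=\{x:\forall y(xRy\to y\in Y)\}$. - $S^{ -1}(X,Y)=\{w:\forall x\in X(wRx\to\exists y\in Y\,xS_wy)\}$. A proper filter is a filter not containing $\emptyset$. For a family $l\subseteq\wp(W)$ and ultrafilters $f,g$, $f\prec_l g$ means the following: for every $A'\subseteq W$ and every finite (possibly empty) family $S_1,\dots,S_n\in l$, if $S^{ -1}(\overline{A'},\overline{S_1}\cup\dots\cup\overline{S_n})\in f$ then $A'\in g$ and $\widehat{R^{ -1}}(A')\in g$. -}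

module Defs where

open import Level using (0ℓ)
open import Data.Empty using (⊥)
open import Data.Unit using (⊤)
open import Data.Product using (Σ; ∃; _×_; _,_)
open import Data.Sum using (_⊎_)
open import Data.List using (List; []; _∷_)
open import Data.List.Relation.Unary.All using (All)
open import Relation.Nullary using (¬_; Dec)
open import Relation.Unary using (Pred; _⊆_; _∩_)
open import Induction.WellFounded using (WellFounded)

Subset : Set → Set₁
Subset W = Pred W 0ℓ

Family : Set → Set₁
Family W = Pred (Subset W) 0ℓ

-- Veltman frame on a carrier W (W nonempty is recorded by a chosen point).
record VeltmanFrame (W : Set) : Set₁ where
  field
    point : W
    R : W → W → Set
    R-trans : ∀ {x y z} → R x y → R y z → R x z
    R-cwf : WellFounded (λ y x → R x y)
    -- S w x y  represents  x S_w y
    S : W → W → W → Set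
    S-dom : ∀ {w x y} → S w x y → R w x × R w y
    S-refl : ∀ {w x} → R w x → S w x x
    S-trans : ∀ {w x y z} → S w x y → S w y z → S w x z
    R⊆S : ∀ {w x y} → R w x → R w y → R x y → S w x y

module _ {W : Set} (F : VeltmanFrame W) where
  open VeltmanFrame F

  comp : Subset W → Subset W
  comp Y x = ¬ Y x

  Rhat : Subset W → Subset W
  Rhat Y x = ∀ y → R x y → Y y

  Sinv : Subset W → Subset W → Subset W
  Sinv X Y w = ∀ x → X x → R w x → ∃ λ y → Y y × S w x y

  unionComp : List (Subset W) → Subset W
  unionComp [] y = ⊥
  unionComp (T ∷ Ts) y = ¬ T y ⊎ unionComp Ts y

  Prec : Family W → Family W → Family W → Set₁
  Prec l f g = ∀ (A' : Subset W) (Ss : List (Subset W)) → All l Ss →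
               f (Sinv (comp A') (unionComp Ss)) → g A' × g (Rhat A')

record IsProperFilter {W : Set} (f : Family W) : Set₁ where
  field
    full : f (λ _ → ⊤)
    upward : ∀ {X Y} → X ⊆ Y → f X → f Y
    meet : ∀ {X Y} → f X → f Y → f (X ∩ Y)
    proper : ¬ f (λ _ → ⊥)

record IsUltrafilter {W : Set} (f : Family W) : Set₁ where
  field
    isProperFilter : IsProperFilter f
    ultra : ∀ X → f X ⊎ f (λ x → ¬ X x)

-- Classical metatheory (ZFC) used by the paper, made explicit:
-- excluded middle and the ultrafilter lemma (every proper filter on a set
-- extends to an ultrafilter).
ExcludedMiddle : Set₁
ExcludedMiddle = (P : Set) → Dec P

UFL : Set → Set₁
UFL W = ∀ (F : Family W) → IsProperFilter F →
        Σ (Family W) λ U → IsUltrafilter U × (F ⊆ U)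

{-# OPTIONS --safe #-}
-- Call x a refutation of w ∈ S⁻¹(A,B) if w R x, x ∈ A and S_w leads from x to
-- no point of B.  The sets X such that f contains {w : every refutation of w lies
-- in X} form a filter containing A, proper because ∁S⁻¹(A,B) ∈ f; extend it to an
-- ultrafilter g, and let l be the principal filter of ∁B (proper for the same
-- reason).  For Sᵢ ∈ l we have ∁S₁ ∪ … ∪ ∁Sₙ ⊆ B, so the premise of f ≺_l g puts
-- S⁻¹(∁A', B) into f.  Refutations of worlds in S⁻¹(∁A', B) lie in A', and since
-- R ⊆ S_w on R[w] this set is contained in S⁻¹(∁R̂⁻¹(A'), B), so they also lie in
-- R̂⁻¹(A').
module Submission where

open import Defs
open import Data.Product using (Σ; _×_)
open import Relation.Nullary using (¬_)
open import Relation.Unary using (Pred)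

open import Function using (id; _∘_)
open import Data.Product using (_,_; ∃)
open import Data.Sum using (inj₁; inj₂)
open import Data.Unit using (tt)
open import Data.List using (_∷_)
open import Data.List.Relation.Unary.All using (All; _∷_)
open import Relation.Nullary.Decidable using (decidable-stable)
open import Relation.Unary using (_⊆_; _∩_; ∅; Empty)

Box : {W : Set} → (W → W → Set) → Subset W → Subset W
Box D X w = ∀ x → D w x → X x

module _ {W : Set} {f : Family W} (f-filter : IsProperFilter f) where
  open IsProperFilter f-filter

  filter-disjoint : {X Y : Subset W} → f X → f Y → ¬ (X ∩ Y ⊆ ∅)
  filter-disjoint fX fY X∩Y⊆∅ = proper (upward X∩Y⊆∅ (meet fX fY))

  filter-∁-full : {X : Subset W} → f (λ w → ¬ X w) → ¬ (∀ w → X w)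
  filter-∁-full f∁X X-full = proper (upward (λ ¬Xw → ¬Xw (X-full _)) f∁X)

  Box-properFilter : (D : W → W → Set) → f (λ w → ¬ Box D ∅ w) →
                     IsProperFilter (λ X → f (Box D X))
  Box-properFilter D f¬Box∅ = record
    { full   = upward (λ _ _ _ → tt) full
    ; upward = λ X⊆Y → upward (λ BoxX x d → X⊆Y (BoxX x d))
    ; meet   = λ fX fY → upward (λ (BoxX , BoxY) x d → BoxX x d , BoxY x d) (meet fX fY)
    ; proper = λ fBox∅ → filter-disjoint fBox∅ f¬Box∅ (λ (Box∅ , ¬Box∅) → ¬Box∅ Box∅)
    }

principal-properFilter : {W : Set} {X : Subset W} → ¬ Empty X → IsProperFilter (X ⊆_)
principal-properFilter X≠∅ = record
  { full   = λ _ → tt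
  ; upward = λ Y⊆Z X⊆Y → Y⊆Z ∘ X⊆Y
  ; meet   = λ X⊆Y X⊆Z Xx → X⊆Y Xx , X⊆Z Xx
  ; proper = λ X⊆∅ → X≠∅ (λ x → X⊆∅ {x})
  }

module _ {W : Set} (F : VeltmanFrame W) where
  open VeltmanFrame F

  Refutes : Subset W → Subset W → W → W → Set
  Refutes A B w x = R w x × A x × (∀ y → B y → ¬ S w x y)

  refutationFilter : Subset W → Subset W → Family W → Family W
  refutationFilter A B f X = f (Box (Refutes A B) X)

  Sinv-monoʳ : ∀ {X Y Y′} → Y ⊆ Y′ → Sinv F X Y ⊆ Sinv F X Y′
  Sinv-monoʳ Y⊆Y′ XY x Xx wRx = let (y , Yy , xSy) = XY x Xx wRx in y , Y⊆Y′ Yy , xSy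

  refutationFilter-∋A : ∀ {f} A B → IsProperFilter f → refutationFilter A B f A
  refutationFilter-∋A A B f-filter = upward (λ _ _ (_ , Ax , _) → Ax) full
    where open IsProperFilter f-filter

  module _ (lem : ExcludedMiddle) where

    ¬¬-elim : {P : Set} → ¬ ¬ P → P
    ¬¬-elim = decidable-stable (lem _)

    Sinv-∁-empty : ∀ {A B} → Empty (comp F B) → ∀ w → Sinv F A B w
    Sinv-∁-empty ∁B-empty w x _ wRx = x , ¬¬-elim (∁B-empty x) , S-refl wRx

    unionComp-⊆ : ∀ {B} Ss → All (comp F B ⊆_) Ss → unionComp F Ss ⊆ B
    unionComp-⊆ (_ ∷ _)  (∁B⊆T ∷ _)   (inj₁ ¬Ty) = ¬¬-elim (λ ¬By → ¬Ty (∁B⊆T ¬By))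
    unionComp-⊆ (_ ∷ Ss) (_    ∷ ∁B⊆) (inj₂ u)   = unionComp-⊆ Ss ∁B⊆ u

    Sinv-∁-Rhat : ∀ {X B} → Sinv F (comp F X) B ⊆ Sinv F (comp F (Rhat F X)) B
    Sinv-∁-Rhat {X} ∁XB x ¬RhatXx wRx =
      let (z , xRz , ¬Xz) = escape
          wRz = R-trans wRx xRz
          (y , By , zSy) = ∁XB z ¬Xz wRz
      in  y , By , S-trans (R⊆S wRx wRz xRz) zSy
      where
      escape : ∃ λ z → R x z × ¬ X z
      escape = ¬¬-elim λ ¬escape →
        ¬RhatXx (λ z xRz → ¬¬-elim (λ ¬Xz → ¬escape (z , xRz , ¬Xz)))

    Sinv-∁-⊆-Box-Refutes : ∀ {X A B} → Sinv F (comp F X) B ⊆ Box (Refutes A B) X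
    Sinv-∁-⊆-Box-Refutes ∁XB x (wRx , _ , noB) = ¬¬-elim λ ¬Xx →
      let (y , By , xSy) = ∁XB x ¬Xx wRx in noB y By xSy

    ∁Sinv-⊆-¬Box-Refutes-∅ : ∀ {A B} → comp F (Sinv F A B) ⊆ (λ w → ¬ Box (Refutes A B) ∅ w)
    ∁Sinv-⊆-¬Box-Refutes-∅ ¬AB Box∅ = ¬AB λ x Ax wRx →
      ¬¬-elim λ ¬reach → Box∅ x (wRx , Ax , λ y By xSy → ¬reach (y , By , xSy))

    refutationFilter-proper : ∀ {f A B} → IsProperFilter f → f (comp F (Sinv F A B)) →
                              IsProperFilter (refutationFilter A B f)
    refutationFilter-proper f-filter f∁AB =
      Box-properFilter f-filter _ (upward ∁Sinv-⊆-¬Box-Refutes-∅ f∁AB)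
      where open IsProperFilter f-filter

    refutationFilter-Prec : ∀ {f g A B} → IsProperFilter f → refutationFilter A B f ⊆ g →
                            Prec F (comp F B ⊆_) f g
    refutationFilter-Prec {f} {B = B} f-filter ⊆g A′ Ss Ss∈l fSinv =
        ⊆g (upward Sinv-∁-⊆-Box-Refutes f∁A′B)
      , ⊆g (upward (Sinv-∁-⊆-Box-Refutes ∘ Sinv-∁-Rhat) f∁A′B)
      where
      open IsProperFilter f-filter
      f∁A′B : f (Sinv F (comp F A′) B)
      f∁A′B = upward (Sinv-monoʳ (unionComp-⊆ Ss Ss∈l)) fSinv

lemma6p2 : (lem : ExcludedMiddle) {W : Set} → (ufl : UFL W) → (F : VeltmanFrame W)
    → (f : Family W) → IsUltrafilter f → (A B : Subset W)
    → f (comp F (Sinv F A B))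
    → Σ (Family W) λ g → Σ (Family W) λ l →
    IsUltrafilter g × IsProperFilter l × g A × l (comp F B) × Prec F l f g
lemma6p2 lem ufl F f f-ultra A B f∁AB =
  let f-filter = IsUltrafilter.isProperFilter f-ultra
      (g , g-ultra , g₀⊆g) = ufl _ (refutationFilter-proper F lem f-filter f∁AB)
      ∁B≠∅ = λ ∁B-empty → filter-∁-full f-filter {Sinv F A B} f∁AB (Sinv-∁-empty F lem {A} ∁B-empty)
  in  g , (comp F B ⊆_)
    , g-ultra
    , principal-properFilter ∁B≠∅
    , g₀⊆g (refutationFilter-∋A F A B f-filter)
    , id
    , refutationFilter-Prec F lem f-filter g₀⊆g
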